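{- Every graph $G$ that is both fork-free and co-dart-free satisfies $\chi(G)\le \binom{\omega(G)+1}{2}$.
   Context: Graphs are finite and simple. A graph $G$ is $H$-free if no induced subgraph of $G$ is isomorphic to $H$. The fork is the graph obtained from $K_{1,3}$ by subdividing one edge once. The paw is a triangle with a pendant vertex; the co-dart is the disjoint union of a paw and a single vertex. $\chi(G)$ is the chromatic number and $\omega(G)$ the clique number of $G$. -}

module Defs where

open import Data.Nat using (ℕ; suc; _*_; _/_)
open import Data.Fin using (Fin; zero; suc)
open import Data.Bool using (Bool; true; false)
open import Data.Product using (Σ; _×_; ∃)
open import Relation.Binary.PropositionalEquality using (_≡_; _≢_)
open import Relation.Nullary using (¬_)
open import Function.Definitions using (Injective)

record Graph (n : ℕ) : Set where
  field
    adj   : Fin n → Fin n → Bool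
    sym   : ∀ i j → adj i j ≡ adj j i
    irrefl : ∀ i → adj i i ≡ false
open Graph public

InducedSub : ∀ {k n} → Graph k → Graph n → Set
InducedSub {k} {n} H G =
  Σ (Fin k → Fin n) λ f → Injective _≡_ _≡_ f × (∀ i j → adj G (f i) (f j) ≡ adj H i j)

_-free : ∀ {k n} → Graph k → Graph n → Set
(H -free) G = ¬ InducedSub H G

-- Fork: K_{1,3} with one edge subdivided once.
-- Vertices: 0 centre, 1 and 2 leaves, 3 middle of the subdivided edge, 4 its end.
-- Edges: 0-1, 0-2, 0-3, 3-4.
forkAdj : Fin 5 → Fin 5 → Bool
forkAdj zero (suc zero) = true
forkAdj zero (suc (suc zero)) = true
forkAdj zero (suc (suc (suc zero))) = true
forkAdj (suc zero) zero = true
forkAdj (suc (suc zero)) zero = true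
forkAdj (suc (suc (suc zero))) zero = true
forkAdj (suc (suc (suc zero))) (suc (suc (suc (suc zero)))) = true
forkAdj (suc (suc (suc (suc zero)))) (suc (suc (suc zero))) = true
forkAdj _ _ = false

fork : Graph 5
fork = record
  { adj = forkAdj
  ; sym = λ { zero zero → _≡_.refl ; zero (suc zero) → _≡_.refl ; zero (suc (suc zero)) → _≡_.refl ; zero (suc (suc (suc zero))) → _≡_.refl ; zero (suc (suc (suc (suc zero)))) → _≡_.refl
            ; (suc zero) zero → _≡_.refl ; (suc zero) (suc zero) → _≡_.refl ; (suc zero) (suc (suc zero)) → _≡_.refl ; (suc zero) (suc (suc (suc zero))) → _≡_.refl ; (suc zero) (suc (suc (suc (suc zero)))) → _≡_.refl
            ; (suc (suc zero)) zero → _≡_.refl ; (suc (suc zero)) (suc zero) → _≡_.refl ; (suc (suc zero)) (suc (suc zero)) → _≡_.refl ; (suc (suc zero)) (suc (suc (suc zero))) → _≡_.refl ; (suc (suc zero)) (suc (suc (suc (suc zero)))) → _≡_.refl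
            ; (suc (suc (suc zero))) zero → _≡_.refl ; (suc (suc (suc zero))) (suc zero) → _≡_.refl ; (suc (suc (suc zero))) (suc (suc zero)) → _≡_.refl ; (suc (suc (suc zero))) (suc (suc (suc zero))) → _≡_.refl ; (suc (suc (suc zero))) (suc (suc (suc (suc zero)))) → _≡_.refl
            ; (suc (suc (suc (suc zero)))) zero → _≡_.refl ; (suc (suc (suc (suc zero)))) (suc zero) → _≡_.refl ; (suc (suc (suc (suc zero)))) (suc (suc zero)) → _≡_.refl ; (suc (suc (suc (suc zero)))) (suc (suc (suc zero))) → _≡_.refl ; (suc (suc (suc (suc zero)))) (suc (suc (suc (suc zero)))) → _≡_.refl }
  ; irrefl = λ { zero → _≡_.refl ; (suc zero) → _≡_.refl ; (suc (suc zero)) → _≡_.refl ; (suc (suc (suc zero))) → _≡_.refl ; (suc (suc (suc (suc zero)))) → _≡_.refl }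
  }

-- Co-dart: paw plus an isolated vertex.
-- Paw: triangle 0-1-2 with pendant vertex 3 attached to 0. Vertex 4 isolated.
-- Edges: 0-1, 0-2, 1-2, 0-3.
codartAdj : Fin 5 → Fin 5 → Bool
codartAdj zero (suc zero) = true
codartAdj zero (suc (suc zero)) = true
codartAdj zero (suc (suc (suc zero))) = true
codartAdj (suc zero) zero = true
codartAdj (suc zero) (suc (suc zero)) = true
codartAdj (suc (suc zero)) zero = true
codartAdj (suc (suc zero)) (suc zero) = true
codartAdj (suc (suc (suc zero))) zero = true
codartAdj _ _ = false

codart : Graph 5
codart = record
  { adj = codartAdj
  ; sym = λ { zero zero → _≡_.refl ; zero (suc zero) → _≡_.refl ; zero (suc (suc zero)) → _≡_.refl ; zero (suc (suc (suc zero))) → _≡_.refl ; zero (suc (suc (suc (suc zero)))) → _≡_.refl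
            ; (suc zero) zero → _≡_.refl ; (suc zero) (suc zero) → _≡_.refl ; (suc zero) (suc (suc zero)) → _≡_.refl ; (suc zero) (suc (suc (suc zero))) → _≡_.refl ; (suc zero) (suc (suc (suc (suc zero)))) → _≡_.refl
            ; (suc (suc zero)) zero → _≡_.refl ; (suc (suc zero)) (suc zero) → _≡_.refl ; (suc (suc zero)) (suc (suc zero)) → _≡_.refl ; (suc (suc zero)) (suc (suc (suc zero))) → _≡_.refl ; (suc (suc zero)) (suc (suc (suc (suc zero)))) → _≡_.refl
            ; (suc (suc (suc zero))) zero → _≡_.refl ; (suc (suc (suc zero))) (suc zero) → _≡_.refl ; (suc (suc (suc zero))) (suc (suc zero)) → _≡_.refl ; (suc (suc (suc zero))) (suc (suc (suc zero))) → _≡_.refl ; (suc (suc (suc zero))) (suc (suc (suc (suc zero)))) → _≡_.refl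
            ; (suc (suc (suc (suc zero)))) zero → _≡_.refl ; (suc (suc (suc (suc zero)))) (suc zero) → _≡_.refl ; (suc (suc (suc (suc zero)))) (suc (suc zero)) → _≡_.refl ; (suc (suc (suc (suc zero)))) (suc (suc (suc zero))) → _≡_.refl ; (suc (suc (suc (suc zero)))) (suc (suc (suc (suc zero)))) → _≡_.refl }
  ; irrefl = λ { zero → _≡_.refl ; (suc zero) → _≡_.refl ; (suc (suc zero)) → _≡_.refl ; (suc (suc (suc zero))) → _≡_.refl ; (suc (suc (suc (suc zero)))) → _≡_.refl }
  }

HasClique : ∀ {n} → Graph n → ℕ → Set
HasClique {n} G k =
  Σ (Fin k → Fin n) λ f → Injective _≡_ _≡_ f × (∀ i j → i ≢ j → adj G (f i) (f j) ≡ true)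

IsCliqueNumber : ∀ {n} → Graph n → ℕ → Set
IsCliqueNumber G w = HasClique G w × ¬ HasClique G (suc w)

Colourable : ∀ {n} → Graph n → ℕ → Set
Colourable {n} G m =
  Σ (Fin n → Fin m) λ c → ∀ i j → adj G i j ≡ true → c i ≢ c j

-- Induction on ω, splitting off the neighbourhood of a vertex v: it has clique number below
-- ω and gets binom(ω, 2) colours, while the non-neighbourhood is paw-free (a paw there plus v
-- is a co-dart) and gets ω colours.  A paw-free graph with clique number at most ω ≥ 3 is
-- ω-colourable: the vertices seeing two vertices of a triangle form a complete multipartite
-- block with no edge leaving it, and triangle-free fork-free graphs are 3-colourable, since
-- around a vertex v of degree ≥ 3 the vertices at distance 0 or 2 from v together with their
-- neighbours form a bipartite block with no edge leaving it.
module Submission where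

open import Defs
open import Data.Nat using (ℕ; suc)
open import Data.Nat.Combinatorics using (_C_)

open import Data.Bool using (true; false; if_then_else_)
import Data.Bool.Properties as Bool
open import Data.Empty using (⊥-elim)
open import Data.Fin as Fin using (Fin; zero; suc; toℕ; #_)
import Data.Fin.Properties as Fin
open import Data.List using (List; []; _∷_; filter; length; allFin)
open import Data.List.Membership.Propositional using (_∈_; _∉_; find; lose)
open import Data.List.Membership.Propositional.Properties using (∈-filter⁺; ∈-filter⁻; ∈-allFin)
open import Data.List.Properties using (filter-notAll)
open import Data.List.Relation.Binary.Subset.Propositional using (_⊆_)
open import Data.List.Relation.Binary.Subset.Propositional.Properties using (filter-⊆)
open import Data.List.Relation.Unary.Any using (Any; here; there; any?; tail)
open import Data.Nat using (zero; _+_; _≤_; _<_; z≤n; s≤s)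
open import Data.Nat.Combinatorics using (nC1≡n; nCk+nC[k+1]≡[n+1]C[k+1])
open import Data.Nat.Induction using (<-wellFounded)
import Data.Nat.Properties as ℕ
open import Data.Product using (∃; ∃₂; Σ; _×_; _,_; proj₁; proj₂)
open import Data.Sum using (_⊎_; inj₁; inj₂; [_,_])
open import Data.Vec using ([]; _∷_; lookup)
open import Function using (_∘_; _on_)
open import Function.Definitions using (Injective)
open import Induction.WellFounded using (Acc; acc)
open import Relation.Binary using (tri<; tri≈; tri>)
open import Relation.Binary.Construct.On using (wellFounded)
open import Relation.Binary.PropositionalEquality
  using (_≡_; _≢_; refl; trans; cong; subst; ≢-sym)
import Relation.Binary.PropositionalEquality as ≡
open import Relation.Nullary using (¬_; Dec; yes; no; does; ¬?)
open import Relation.Nullary.Decidable using (_×-dec_; _⊎-dec_; _→-dec_; from-yes; map′)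
open import Relation.Unary using (Decidable)
open import Relation.Unary.Properties using (∁?)

two-of-three : {P : Fin 3 → Set} → (∀ i j → i ≢ j → P i ⊎ P j) →
               ∃₂ λ i j → i ≢ j × P i × P j
two-of-three hits with hits (# 0) (# 1) (λ ())
... | inj₁ p₀ with hits (# 1) (# 2) (λ ())
...   | inj₁ p₁ = # 0 , # 1 , (λ ()) , p₀ , p₁
...   | inj₂ p₂ = # 0 , # 2 , (λ ()) , p₀ , p₂
two-of-three hits | inj₂ p₁ with hits (# 0) (# 2) (λ ())
...   | inj₁ p₀ = # 0 , # 1 , (λ ()) , p₀ , p₁
...   | inj₂ p₂ = # 1 , # 2 , (λ ()) , p₁ , p₂

suc-C-2 : ∀ k → suc k C 2 ≡ k C 2 + k
suc-C-2 k = trans (≡.sym (nCk+nC[k+1]≡[n+1]C[k+1] k 1))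
                  (trans (cong (_+ k C 2) (nC1≡n k)) (ℕ.+-comm k (k C 2)))

Twins : ∀ {k} → Graph k → Fin k → Fin k → Set
Twins H i j = ∀ l → adj H i l ≡ adj H j l

twins? : ∀ {k} (H : Graph k) i j → Dec (Twins H i j)
twins? H i j = Fin.all? λ l → adj H i l Bool.≟ adj H j l

codart-twinFree : ∀ {i j} → Twins codart i j → i ≡ j
codart-twinFree {i} {j} =
  from-yes (Fin.all? λ i → Fin.all? λ j → twins? codart i j →-dec i Fin.≟ j) i j

fork-twins : ∀ {i j} → Twins fork i j →
             i ≡ j ⊎ (i ≡ # 1 × j ≡ # 2) ⊎ (i ≡ # 2 × j ≡ # 1)
fork-twins {i} {j} =
  from-yes (Fin.all? λ i → Fin.all? λ j → twins? fork i j →-dec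
              (i Fin.≟ j ⊎-dec (i Fin.≟ # 1 ×-dec j Fin.≟ # 2)
                         ⊎-dec (i Fin.≟ # 2 ×-dec j Fin.≟ # 1)))
           i j

_<ₗ_ : ∀ {A : Set} → List A → List A → Set
_<ₗ_ = _<_ on length

<ₗ-wellFounded : ∀ {A : Set} (xs : List A) → Acc _<ₗ_ xs
<ₗ-wellFounded = wellFounded length <-wellFounded

module _ {n : ℕ} (G : Graph n) where

  infix 4 _~_
  _~_ : Fin n → Fin n → Set
  x ~ y = adj G x y ≡ true

  _~?_ : ∀ x y → Dec (x ~ y)
  x ~? y = adj G x y Bool.≟ true

  ~-sym : ∀ {x y} → x ~ y → y ~ x
  ~-sym {x} {y} x~y = trans (Graph.sym G y x) x~y

  ~-irrefl : ∀ {x} → ¬ x ~ x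
  ~-irrefl {x} x~x with trans (≡.sym x~x) (Graph.irrefl G x)
  ... | ()

  ≁-sym : ∀ {x y} → ¬ x ~ y → ¬ y ~ x
  ≁-sym x≁y = x≁y ∘ ~-sym

  ≁⇒false : ∀ {x y} → ¬ x ~ y → adj G x y ≡ false
  ≁⇒false = Bool.¬-not

  induced-copy : ∀ {k} {H : Graph k} (f : Fin k → Fin n) →
                 (∀ {i j} → i Fin.< j → adj G (f i) (f j) ≡ adj H i j) →
                 (∀ {i j} → Twins H i j → f i ≡ f j → i ≡ j) → InducedSub H G
  induced-copy {H = H} f upper separates = f , injective , preserves
    where
    preserves : ∀ i j → adj G (f i) (f j) ≡ adj H i j
    preserves i j with Fin.<-cmp i j
    ... | tri< i<j _ _ = upper i<j
    ... | tri≈ _ refl _ = trans (Graph.irrefl G (f i)) (≡.sym (Graph.irrefl H i))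
    ... | tri> _ _ j<i = trans (Graph.sym G (f i) (f j)) (trans (upper j<i) (Graph.sym H j i))
    injective : Injective _≡_ _≡_ f
    injective {i} {j} fi≡fj = separates twins fi≡fj
      where
      twins : Twins H i j
      twins l = trans (≡.sym (preserves i l))
                      (trans (cong (λ x → adj G x (f l)) fi≡fj) (preserves j l))

  fork-free⇒ : (fork -free) G → ∀ {a b c d e} →
               a ~ b → a ~ c → a ~ d → d ~ e → b ≢ c →
               ¬ b ~ c → ¬ b ~ d → ¬ c ~ d → ¬ a ~ e → b ~ e ⊎ c ~ e
  fork-free⇒ no-fork {a} {b} {c} {d} {e} a~b a~c a~d d~e b≢c b≁c b≁d c≁d a≁e
    with b ~? e | c ~? e
  ... | yes b~e | _ = inj₁ b~e
  ... | no _ | yes c~e = inj₂ c~e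
  ... | no b≁e | no c≁e = ⊥-elim (no-fork (induced-copy {H = fork} f upper separates))
    where
    f : Fin 5 → Fin n
    f = lookup (a ∷ b ∷ c ∷ d ∷ e ∷ [])
    upper : ∀ {i j} → i Fin.< j → adj G (f i) (f j) ≡ adj fork i j
    upper {zero} {suc zero} _ = a~b
    upper {zero} {suc (suc zero)} _ = a~c
    upper {zero} {suc (suc (suc zero))} _ = a~d
    upper {zero} {suc (suc (suc (suc zero)))} _ = ≁⇒false a≁e
    upper {suc zero} {suc (suc zero)} _ = ≁⇒false b≁c
    upper {suc zero} {suc (suc (suc zero))} _ = ≁⇒false b≁d
    upper {suc zero} {suc (suc (suc (suc zero)))} _ = ≁⇒false b≁e
    upper {suc (suc zero)} {suc (suc (suc zero))} _ = ≁⇒false c≁d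
    upper {suc (suc zero)} {suc (suc (suc (suc zero)))} _ = ≁⇒false c≁e
    upper {suc (suc (suc zero))} {suc (suc (suc (suc zero)))} _ = d~e
    upper {_} {zero} ()
    upper {suc _} {suc zero} (s≤s ())
    upper {suc (suc _)} {suc (suc zero)} (s≤s (s≤s ()))
    upper {suc (suc (suc _))} {suc (suc (suc zero))} (s≤s (s≤s (s≤s ())))
    upper {suc (suc (suc (suc _)))} {suc (suc (suc (suc zero)))} (s≤s (s≤s (s≤s (s≤s ()))))
    separates : ∀ {i j} → Twins fork i j → f i ≡ f j → i ≡ j
    separates twins fi≡fj with fork-twins twins
    ... | inj₁ i≡j = i≡j
    ... | inj₂ (inj₁ (refl , refl)) = ⊥-elim (b≢c fi≡fj)
    ... | inj₂ (inj₂ (refl , refl)) = ⊥-elim (b≢c (≡.sym fi≡fj))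

  codart-free⇒ : (codart -free) G → ∀ {a b c d e} →
                 a ~ b → a ~ c → b ~ c → a ~ d →
                 ¬ e ~ a → ¬ e ~ b → ¬ e ~ c → ¬ e ~ d → b ~ d ⊎ c ~ d
  codart-free⇒ no-codart {a} {b} {c} {d} {e} a~b a~c b~c a~d e≁a e≁b e≁c e≁d
    with b ~? d | c ~? d
  ... | yes b~d | _ = inj₁ b~d
  ... | no _ | yes c~d = inj₂ c~d
  ... | no b≁d | no c≁d =
    ⊥-elim (no-codart (induced-copy {H = codart} f upper (λ twins _ → codart-twinFree twins)))
    where
    f : Fin 5 → Fin n
    f = lookup (a ∷ b ∷ c ∷ d ∷ e ∷ [])
    upper : ∀ {i j} → i Fin.< j → adj G (f i) (f j) ≡ adj codart i j
    upper {zero} {suc zero} _ = a~b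
    upper {zero} {suc (suc zero)} _ = a~c
    upper {zero} {suc (suc (suc zero))} _ = a~d
    upper {zero} {suc (suc (suc (suc zero)))} _ = ≁⇒false (≁-sym e≁a)
    upper {suc zero} {suc (suc zero)} _ = b~c
    upper {suc zero} {suc (suc (suc zero))} _ = ≁⇒false b≁d
    upper {suc zero} {suc (suc (suc (suc zero)))} _ = ≁⇒false (≁-sym e≁b)
    upper {suc (suc zero)} {suc (suc (suc zero))} _ = ≁⇒false c≁d
    upper {suc (suc zero)} {suc (suc (suc (suc zero)))} _ = ≁⇒false (≁-sym e≁c)
    upper {suc (suc (suc zero))} {suc (suc (suc (suc zero)))} _ = ≁⇒false (≁-sym e≁d)
    upper {_} {zero} ()
    upper {suc _} {suc zero} (s≤s ())
    upper {suc (suc _)} {suc (suc zero)} (s≤s (s≤s ()))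
    upper {suc (suc (suc _))} {suc (suc (suc zero))} (s≤s (s≤s (s≤s ())))
    upper {suc (suc (suc (suc _)))} {suc (suc (suc (suc zero)))} (s≤s (s≤s (s≤s (s≤s ()))))

  Clique : List (Fin n) → ℕ → Set
  Clique S k = Σ (Fin k → Fin n) λ f → (∀ i → f i ∈ S) × (∀ {i j} → i ≢ j → f i ~ f j)

  clique-⊆ : ∀ {S T k} → S ⊆ T → Clique S k → Clique T k
  clique-⊆ S⊆T (f , f∈S , f~) = f , S⊆T ∘ f∈S , f~

  clique-∷ : ∀ {v S k} → v ∈ S → Clique (filter (v ~?_) S) k → Clique S (suc k)
  clique-∷ {v} {S} {k} v∈S (f , f∈ , f~) = g , g∈S , g~
    where
    from-filter : ∀ {x} → x ∈ filter (v ~?_) S → x ∈ S × v ~ x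
    from-filter = ∈-filter⁻ (v ~?_) {xs = S}
    g : Fin (suc k) → Fin n
    g zero = v
    g (suc i) = f i
    g∈S : ∀ i → g i ∈ S
    g∈S zero = v∈S
    g∈S (suc i) = proj₁ (from-filter (f∈ i))
    g~ : ∀ {i j} → i ≢ j → g i ~ g j
    g~ {zero} {zero} i≢j = ⊥-elim (i≢j refl)
    g~ {zero} {suc j} _ = proj₂ (from-filter (f∈ j))
    g~ {suc i} {zero} _ = ~-sym (proj₂ (from-filter (f∈ i)))
    g~ {suc i} {suc j} i≢j = f~ (i≢j ∘ cong suc)

  clique₁ : ∀ {x S} → x ∈ S → Clique S 1
  clique₁ {x} x∈S = (λ _ → x) , (λ _ → x∈S) , λ { {zero} {zero} i≢j → ⊥-elim (i≢j refl) }

  clique₂ : ∀ {x y S} → x ∈ S → y ∈ S → x ~ y → Clique S 2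
  clique₂ x∈S y∈S x~y = clique-∷ x∈S (clique₁ (∈-filter⁺ (_ ~?_) y∈S x~y))

  clique₃ : ∀ {a b c S} → a ∈ S → b ∈ S → c ∈ S → a ~ b → a ~ c → b ~ c → Clique S 3
  clique₃ a∈S b∈S c∈S a~b a~c b~c =
    clique-∷ a∈S (clique₂ (∈-filter⁺ (_ ~?_) b∈S a~b) (∈-filter⁺ (_ ~?_) c∈S a~c) b~c)

  clique₃? : ∀ S → Dec (Clique S 3)
  clique₃? S = map′ from-triple to-triple
    (any? (λ a → any? (λ b → any? (λ c → a ~? b ×-dec a ~? c ×-dec b ~? c) S) S) S)
    where
    from-triple : Any (λ a → Any (λ b → Any (λ c → a ~ b × a ~ c × b ~ c) S) S) S → Clique S 3
    from-triple triple with find triple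
    ... | a , a∈S , pairs with find pairs
    ... | b , b∈S , edges with find edges
    ... | c , c∈S , a~b , a~c , b~c = clique₃ a∈S b∈S c∈S a~b a~c b~c
    to-triple : Clique S 3 → Any (λ a → Any (λ b → Any (λ c → a ~ b × a ~ c × b ~ c) S) S) S
    to-triple (f , f∈S , f~) =
      lose (f∈S (# 0)) (lose (f∈S (# 1)) (lose (f∈S (# 2)) (f~ (λ ()) , f~ (λ ()) , f~ (λ ()))))

  hasClique : ∀ {k} → Clique (allFin n) k → HasClique G k
  hasClique (f , _ , f~) = f , injective , λ i j i≢j → f~ i≢j
    where
    injective : Injective _≡_ _≡_ f
    injective {i} {j} fi≡fj with i Fin.≟ j
    ... | yes i≡j = i≡j
    ... | no i≢j = ⊥-elim (~-irrefl (subst (λ x → f i ~ x) (≡.sym fi≡fj) (f~ i≢j)))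

  -- Colours are naturals bounded only on S, so that an empty S has a colouring with
  -- 0 colours even when n > 0.
  record Colouring (S : List (Fin n)) (m : ℕ) : Set where
    constructor colouring
    field
      colour  : Fin n → ℕ
      colour< : ∀ {x} → x ∈ S → colour x < m
      proper  : ∀ {x y} → x ∈ S → y ∈ S → x ~ y → colour x ≢ colour y

  colourable : ∀ {m} → Colouring (allFin n) m → Colourable G m
  colourable (colouring c c< proper) = c′ , λ i j i~j c′i≡c′j →
    proper (∈-allFin i) (∈-allFin j) i~j
      (trans (≡.sym (Fin.toℕ-fromℕ< (c< (∈-allFin i))))
             (trans (cong toℕ c′i≡c′j) (Fin.toℕ-fromℕ< (c< (∈-allFin j)))))
    where
    c′ : Fin n → Fin _
    c′ i = Fin.fromℕ< (c< (∈-allFin i))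

  colouring-≤ : ∀ {S m m′} → m ≤ m′ → Colouring S m → Colouring S m′
  colouring-≤ m≤m′ (colouring c c< proper) = colouring c (λ x∈S → ℕ.<-≤-trans (c< x∈S) m≤m′) proper

  colouring-empty : ∀ {S m} → (∀ {x} → x ∉ S) → Colouring S m
  colouring-empty ∉S = colouring (λ _ → 0) (⊥-elim ∘ ∉S) (λ x∈S _ _ → ⊥-elim (∉S x∈S))

  Independent : List (Fin n) → Set
  Independent S = ∀ {x y} → x ∈ S → y ∈ S → ¬ x ~ y

  independent-colouring : ∀ {S} → Independent S → Colouring S 1
  independent-colouring indep =
    colouring (λ _ → 0) (λ _ → s≤s z≤n) (λ x∈S y∈S x~y _ → indep x∈S y∈S x~y)

  module _ {P : Fin n → Set} (P? : Decidable P) {S : List (Fin n)} where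

    private
      inside : ∀ {x} → x ∈ S → P x → x ∈ filter P? S
      inside = ∈-filter⁺ P?

      outside : ∀ {x} → x ∈ S → ¬ P x → x ∈ filter (∁? P?) S
      outside = ∈-filter⁺ (∁? P?)

    colouring-split : ∀ {a b} → Colouring (filter P? S) a → Colouring (filter (∁? P?) S) b →
                      Colouring S (a + b)
    colouring-split {a} {b} (colouring c₁ c₁< proper₁) (colouring c₂ c₂< proper₂) =
      colouring c c< proper
      where
      c : Fin n → ℕ
      c x = if does (P? x) then c₁ x else a + c₂ x
      below-shift : ∀ {x} → x ∈ S → P x → ∀ k → c₁ x < a + k
      below-shift x∈S Px k = ℕ.<-≤-trans (c₁< (inside x∈S Px)) (ℕ.m≤m+n a k)
      c< : ∀ {x} → x ∈ S → c x < a + b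
      c< {x} x∈S with P? x
      ... | yes Px = below-shift x∈S Px b
      ... | no ¬Px = ℕ.+-monoʳ-< a (c₂< (outside x∈S ¬Px))
      proper : ∀ {x y} → x ∈ S → y ∈ S → x ~ y → c x ≢ c y
      proper {x} {y} x∈S y∈S x~y with P? x | P? y
      ... | yes Px | yes Py = proper₁ (inside x∈S Px) (inside y∈S Py) x~y
      ... | yes Px | no _ = ℕ.<⇒≢ (below-shift x∈S Px _)
      ... | no _ | yes Py = ≢-sym (ℕ.<⇒≢ (below-shift y∈S Py _))
      ... | no ¬Px | no ¬Py =
        proper₂ (outside x∈S ¬Px) (outside y∈S ¬Py) x~y ∘ ℕ.+-cancelˡ-≡ a _ _

    colouring-separated : ∀ {m} → (∀ {x y} → x ∈ S → y ∈ S → P x → x ~ y → P y) →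
                          Colouring (filter P? S) m → Colouring (filter (∁? P?) S) m →
                          Colouring S m
    colouring-separated {m} closed (colouring c₁ c₁< proper₁) (colouring c₂ c₂< proper₂) =
      colouring c c< proper
      where
      c : Fin n → ℕ
      c x = if does (P? x) then c₁ x else c₂ x
      c< : ∀ {x} → x ∈ S → c x < m
      c< {x} x∈S with P? x
      ... | yes Px = c₁< (inside x∈S Px)
      ... | no ¬Px = c₂< (outside x∈S ¬Px)
      proper : ∀ {x y} → x ∈ S → y ∈ S → x ~ y → c x ≢ c y
      proper {x} {y} x∈S y∈S x~y with P? x | P? y
      ... | yes Px | yes Py = proper₁ (inside x∈S Px) (inside y∈S Py) x~y
      ... | yes Px | no ¬Py = ⊥-elim (¬Py (closed x∈S y∈S Px x~y))
      ... | no ¬Px | yes Py = ⊥-elim (¬Px (closed y∈S x∈S Py (~-sym x~y)))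
      ... | no ¬Px | no ¬Py = proper₂ (outside x∈S ¬Px) (outside y∈S ¬Py) x~y

  DistinctNeighbours : Fin n → List (Fin n) → ℕ → Set
  DistinctNeighbours u S m =
    Σ (Fin m → Fin n) λ g → Injective _≡_ _≡_ g × (∀ i → g i ∈ S × u ~ g i)

  distinctNeighbours-⊆ : ∀ {u S T m} → S ⊆ T → DistinctNeighbours u S m → DistinctNeighbours u T m
  distinctNeighbours-⊆ S⊆T (g , g-injective , g-props) =
    g , g-injective , λ i → S⊆T (proj₁ (g-props i)) , proj₂ (g-props i)

  module Greedy {u : Fin n} {S : List (Fin n)} {m : ℕ} (χ : Colouring S m) where
    open Colouring χ

    Used : Fin m → Set
    Used k = Any (λ w → u ~ w × colour w ≡ toℕ k) S

    used? : Decidable Used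
    used? k = any? (λ w → u ~? w ×-dec colour w ℕ.≟ toℕ k) S

    extend : ∃ (¬_ ∘ Used) → Colouring (u ∷ S) m
    extend (k , unused) = colouring c c< proper′
      where
      c : Fin n → ℕ
      c x = if does (x Fin.≟ u) then toℕ k else colour x
      c< : ∀ {x} → x ∈ u ∷ S → c x < m
      c< {x} x∈ with x Fin.≟ u
      ... | yes _ = Fin.toℕ<n k
      ... | no x≢u = colour< (tail x≢u x∈)
      proper′ : ∀ {x y} → x ∈ u ∷ S → y ∈ u ∷ S → x ~ y → c x ≢ c y
      proper′ {x} {y} x∈ y∈ x~y with x Fin.≟ u | y Fin.≟ u
      ... | yes refl | yes refl = ⊥-elim (~-irrefl x~y)
      ... | yes refl | no y≢u = λ k≡cy → unused (lose (tail y≢u y∈) (x~y , ≡.sym k≡cy))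
      ... | no x≢u | yes refl = λ cx≡k → unused (lose (tail x≢u x∈) (~-sym x~y , cx≡k))
      ... | no x≢u | no y≢u = proper (tail x≢u x∈) (tail y≢u y∈) x~y

    neighbours : (∀ k → Used k) → DistinctNeighbours u S m
    neighbours used = g , g-injective , λ k → proj₁ (proj₂ (find (used k))) ,
                                             proj₁ (proj₂ (proj₂ (find (used k))))
      where
      g : Fin m → Fin n
      g k = proj₁ (find (used k))
      colour-g : ∀ k → colour (g k) ≡ toℕ k
      colour-g k = proj₂ (proj₂ (proj₂ (find (used k))))
      g-injective : Injective _≡_ _≡_ g
      g-injective {i} {j} gi≡gj =
        Fin.toℕ-injective (trans (≡.sym (colour-g i)) (trans (cong colour gi≡gj) (colour-g j)))

    extension : Colouring (u ∷ S) m ⊎ DistinctNeighbours u S m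
    extension with Fin.all? used?
    ... | yes all-used = inj₂ (neighbours all-used)
    ... | no ¬all-used = inj₁ (extend (Fin.¬∀⟶∃¬ m Used used? ¬all-used))

  colouring-∷ : ∀ {u S m} → Colouring S m → Colouring (u ∷ S) m ⊎ DistinctNeighbours u S m
  colouring-∷ = Greedy.extension

  CompleteMultipartite : List (Fin n) → Set
  CompleteMultipartite S = ∀ {x y z} → x ∈ S → y ∈ S → z ∈ S → ¬ x ~ y → ¬ y ~ z → ¬ x ~ z

  completeMultipartite-⊆ : ∀ {S T} → S ⊆ T → CompleteMultipartite T → CompleteMultipartite S
  completeMultipartite-⊆ S⊆T multi x∈ y∈ z∈ = multi (S⊆T x∈) (S⊆T y∈) (S⊆T z∈)

  completeMultipartite-colouring : ∀ m {S} → CompleteMultipartite S → ¬ Clique S (suc m) →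
                                   Colouring S m
  completeMultipartite-colouring _ {[]} _ _ = colouring-empty λ ()
  completeMultipartite-colouring zero {u ∷ S} _ no-clique = ⊥-elim (no-clique (clique₁ (here refl)))
  completeMultipartite-colouring (suc m) {u ∷ S} multi no-clique =
    colouring-≤ (ℕ.≤-reflexive (ℕ.+-comm m 1)) (colouring-split (u ~?_) neighbours others)
    where
    neighbours : Colouring (filter (u ~?_) (u ∷ S)) m
    neighbours =
      completeMultipartite-colouring m (completeMultipartite-⊆ (filter-⊆ (u ~?_) (u ∷ S)) multi)
                                       (no-clique ∘ clique-∷ (here refl))
    others : Colouring (filter (∁? (u ~?_)) (u ∷ S)) 1
    others = independent-colouring λ x∈ y∈ →
      let x∈S , u≁x = ∈-filter⁻ (∁? (u ~?_)) x∈
          y∈S , u≁y = ∈-filter⁻ (∁? (u ~?_)) y∈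
      in multi x∈S (here refl) y∈S (≁-sym u≁x) u≁y

  PawFree : List (Fin n) → Set
  PawFree S = ∀ {a b c d} → a ∈ S → b ∈ S → c ∈ S → d ∈ S →
              a ~ b → a ~ c → b ~ c → a ~ d → b ~ d ⊎ c ~ d

  pawFree-⊆ : ∀ {S T} → S ⊆ T → PawFree T → PawFree S
  pawFree-⊆ S⊆T paw-free a∈ b∈ c∈ d∈ = paw-free (S⊆T a∈) (S⊆T b∈) (S⊆T c∈) (S⊆T d∈)

  module _ (no-fork : (fork -free) G) where

    module BipartiteBlock {S : List (Fin n)} {v : Fin n} (no-triangle : ¬ Clique S 3) (v∈S : v ∈ S)
                          (neighbours : DistinctNeighbours v S 3) where

      private
        nbr : Fin 3 → Fin n
        nbr = proj₁ neighbours

        nbr-injective : Injective _≡_ _≡_ nbr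
        nbr-injective = proj₁ (proj₂ neighbours)

        nbr∈S : ∀ i → nbr i ∈ S
        nbr∈S = proj₁ ∘ proj₂ (proj₂ neighbours)

        v~nbr : ∀ i → v ~ nbr i
        v~nbr = proj₂ ∘ proj₂ (proj₂ neighbours)

        apart : ∀ {a b c} → a ∈ S → b ∈ S → c ∈ S → a ~ b → a ~ c → ¬ b ~ c
        apart a∈S b∈S c∈S a~b a~c = no-triangle ∘ clique₃ a∈S b∈S c∈S a~b a~c

      -- The vertices at distance 0 or 2 from v; v itself qualifies since it has a neighbour.
      Even : Fin n → Set
      Even x = ¬ v ~ x × Any (λ c → v ~ c × c ~ x) S

      even? : Decidable Even
      even? x = ¬? (v ~? x) ×-dec any? (λ c → v ~? c ×-dec c ~? x) S

      Block : Fin n → Set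
      Block x = Even x ⊎ Any (λ w → Even w × w ~ x) S

      block? : Decidable Block
      block? x = even? x ⊎-dec any? (λ w → even? w ×-dec w ~? x) S

      even-intro : ∀ {t x} → t ∈ S → x ∈ S → v ~ t → t ~ x → Even x
      even-intro t∈S x∈S v~t t~x = apart t∈S v∈S x∈S (~-sym v~t) t~x , lose t∈S (v~t , t~x)

      even-hits : ∀ {x} → Even x → ∀ i j → i ≢ j → nbr i ~ x ⊎ nbr j ~ x
      even-hits (v≁x , path) i j i≢j with find path
      ... | c , c∈S , v~c , c~x =
        fork-free⇒ no-fork (v~nbr i) (v~nbr j) v~c c~x (i≢j ∘ nbr-injective)
          (apart v∈S (nbr∈S i) (nbr∈S j) (v~nbr i) (v~nbr j))
          (apart v∈S (nbr∈S i) c∈S (v~nbr i) v~c)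
          (apart v∈S (nbr∈S j) c∈S (v~nbr j) v~c) v≁x

      even-independent : ∀ {x y} → x ∈ S → y ∈ S → Even x → Even y → ¬ x ~ y
      even-independent x∈S y∈S even-x even-y x~y with two-of-three (even-hits even-x)
      ... | i , j , i≢j , i~x , j~x =
        [ (λ i~y → apart (nbr∈S i) x∈S y∈S i~x i~y x~y)
        , (λ j~y → apart (nbr∈S j) x∈S y∈S j~x j~y x~y) ] (even-hits even-y i j i≢j)

      even-step : ∀ {w u x} → w ∈ S → u ∈ S → x ∈ S → Even w → w ~ u → u ~ x → Even x
      even-step w∈S u∈S x∈S even-w w~u u~x with two-of-three (even-hits even-w)
      ... | i , j , i≢j , i~w , j~w =
        [ even-intro (nbr∈S i) x∈S (v~nbr i) , even-intro (nbr∈S j) x∈S (v~nbr j) ]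
        (fork-free⇒ no-fork (~-sym i~w) (~-sym j~w) w~u u~x (i≢j ∘ nbr-injective)
          (apart v∈S (nbr∈S i) (nbr∈S j) (v~nbr i) (v~nbr j))
          (apart w∈S (nbr∈S i) u∈S (~-sym i~w) w~u)
          (apart w∈S (nbr∈S j) u∈S (~-sym j~w) w~u)
          (apart u∈S w∈S x∈S (~-sym w~u) u~x))

      block-closed : ∀ {x y} → x ∈ S → y ∈ S → Block x → x ~ y → Block y
      block-closed x∈S y∈S (inj₁ even-x) x~y = inj₂ (lose x∈S (even-x , x~y))
      block-closed x∈S y∈S (inj₂ edge) x~y with find edge
      ... | w , w∈S , even-w , w~x = inj₁ (even-step w∈S x∈S y∈S even-w w~x x~y)

      odd-independent : ∀ {x y} → x ∈ S → y ∈ S → Block x → ¬ Even x → ¬ Even y → ¬ x ~ y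
      odd-independent x∈S y∈S (inj₁ even-x) odd-x _ _ = odd-x even-x
      odd-independent x∈S y∈S (inj₂ edge) _ odd-y x~y with find edge
      ... | w , w∈S , even-w , w~x = odd-y (even-step w∈S x∈S y∈S even-w w~x x~y)

      block-colouring : Colouring (filter block? S) 2
      block-colouring = colouring-split even?
        (independent-colouring λ x∈ y∈ →
          let x∈S , _ , even-x = block-member even? x∈
              y∈S , _ , even-y = block-member even? y∈
          in even-independent x∈S y∈S even-x even-y)
        (independent-colouring λ x∈ y∈ →
          let x∈S , block-x , odd-x = block-member (∁? even?) x∈
              y∈S , _ , odd-y = block-member (∁? even?) y∈
          in odd-independent x∈S y∈S block-x odd-x odd-y)
        where
        block-member : ∀ {P : Fin n → Set} (P? : Decidable P) {x} →
                       x ∈ filter P? (filter block? S) → x ∈ S × Block x × P x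
        block-member P? x∈ =
          let x∈B , Px = ∈-filter⁻ P? x∈
              x∈S , block-x = ∈-filter⁻ block? x∈B
          in x∈S , block-x , Px

      v-in-block : Block v
      v-in-block = inj₁ (~-irrefl , lose (nbr∈S (# 0)) (v~nbr (# 0) , ~-sym (v~nbr (# 0))))

      rest-shorter : filter (∁? block?) S <ₗ S
      rest-shorter = filter-notAll (∁? block?) S (lose v∈S (λ outside → outside v-in-block))

      colouring-from-rest : Colouring (filter (∁? block?) S) 3 → Colouring S 3
      colouring-from-rest = colouring-separated block? block-closed
                              (colouring-≤ (s≤s (s≤s z≤n)) block-colouring)

    triangleFree-colouring : ∀ S → ¬ Clique S 3 → Colouring S 3
    triangleFree-colouring S = go S (<ₗ-wellFounded S)
      where
      go : ∀ S → Acc _<ₗ_ S → ¬ Clique S 3 → Colouring S 3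
      go [] _ _ = colouring-empty λ ()
      go (u ∷ S) (acc shorter) no-triangle
        with colouring-∷ (go S (shorter (ℕ.n<1+n _)) (no-triangle ∘ clique-⊆ there))
      ... | inj₁ χ = χ
      ... | inj₂ neighbours =
        B.colouring-from-rest
          (go _ (shorter B.rest-shorter) (no-triangle ∘ clique-⊆ (filter-⊆ (∁? B.block?) (u ∷ S))))
        where
        module B = BipartiteBlock no-triangle (here refl) (distinctNeighbours-⊆ there neighbours)

    module MultipartiteBlock {S : List (Fin n)} (paw-free : PawFree S) (triangle : Clique S 3) where

      private
        t : Fin 3 → Fin n
        t = proj₁ triangle

        t∈S : ∀ i → t i ∈ S
        t∈S = proj₁ (proj₂ triangle)

        t~ : ∀ {i j} → i ≢ j → t i ~ t j
        t~ = proj₂ (proj₂ triangle)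

      -- x sees at least two vertices of the triangle, i.e. one vertex of every pair.
      Block : Fin n → Set
      Block x = ∀ i j → i ≢ j → t i ~ x ⊎ t j ~ x

      block? : Decidable Block
      block? x = Fin.all? λ i → Fin.all? λ j → ¬? (i Fin.≟ j) →-dec (t i ~? x ⊎-dec t j ~? x)

      sees-one⇒block : ∀ {k x} → x ∈ S → t k ~ x → Block x
      sees-one⇒block {k} x∈S k~x i j i≢j with k Fin.≟ i | k Fin.≟ j
      ... | yes refl | _ = inj₁ k~x
      ... | no _ | yes refl = inj₂ k~x
      ... | no k≢i | no k≢j =
        paw-free (t∈S k) (t∈S i) (t∈S j) x∈S (t~ k≢i) (t~ k≢j) (t~ i≢j) k~x

      block-closed : ∀ {x y} → x ∈ S → y ∈ S → Block x → x ~ y → Block y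
      block-closed x∈S y∈S block-x x~y with two-of-three block-x
      ... | i , j , i≢j , i~x , j~x =
        [ sees-one⇒block y∈S , sees-one⇒block y∈S ]
        (paw-free x∈S (t∈S i) (t∈S j) y∈S (~-sym i~x) (~-sym j~x) (t~ i≢j) x~y)

      block-multipartite : CompleteMultipartite (filter block? S)
      block-multipartite {x} {y} {z} x∈ y∈ z∈ x≁y y≁z x~z
        with ∈-filter⁻ block? x∈ | ∈-filter⁻ block? y∈ | ∈-filter⁻ block? z∈
      ... | x∈S , block-x | y∈S , block-y | z∈S , block-z with two-of-three block-y
      ... | i , j , i≢j , i~y , j~y =
        [ x≁y , ≁-sym y≁z ] (paw-free (t∈S i) x∈S z∈S y∈S i~x i~z x~z i~y)
        where
        sees-i : ∀ {u} → u ∈ S → Block u → ¬ y ~ u → t i ~ u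
        sees-i u∈S block-u y≁u with block-u i j i≢j
        ... | inj₁ i~u = i~u
        ... | inj₂ j~u =
          [ (λ i~u → i~u) , (⊥-elim ∘ y≁u) ]
          (paw-free (t∈S j) (t∈S i) y∈S u∈S (t~ (i≢j ∘ ≡.sym)) j~y i~y j~u)
        i~x : t i ~ x
        i~x = sees-i x∈S block-x (≁-sym x≁y)
        i~z : t i ~ z
        i~z = sees-i z∈S block-z y≁z

      block-colouring : ∀ m → ¬ Clique S (suc m) → Colouring (filter block? S) m
      block-colouring m no-clique =
        completeMultipartite-colouring m block-multipartite (no-clique ∘ clique-⊆ (filter-⊆ _ _))

      rest-shorter : filter (∁? block?) S <ₗ S
      rest-shorter = filter-notAll (∁? block?) S
        (lose (t∈S (# 0)) (λ outside → outside (sees-one⇒block (t∈S (# 0)) (t~ {# 1} (λ ())))))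

      colouring-from-rest : ∀ {m} → ¬ Clique S (suc m) → Colouring (filter (∁? block?) S) m →
                            Colouring S m
      colouring-from-rest no-clique =
        colouring-separated block? block-closed (block-colouring _ no-clique)

    pawFree-colouring : ∀ {m} S → 3 ≤ m → PawFree S → ¬ Clique S (suc m) → Colouring S m
    pawFree-colouring {m} S 3≤m = go S (<ₗ-wellFounded S)
      where
      go : ∀ S → Acc _<ₗ_ S → PawFree S → ¬ Clique S (suc m) → Colouring S m
      go S (acc shorter) paw-free no-clique with clique₃? S
      ... | no no-triangle = colouring-≤ 3≤m (triangleFree-colouring S no-triangle)
      ... | yes triangle =
        B.colouring-from-rest no-clique
          (go _ (shorter B.rest-shorter) (pawFree-⊆ (filter-⊆ _ _) paw-free)
              (no-clique ∘ clique-⊆ (filter-⊆ _ _)))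
        where
        module B = MultipartiteBlock paw-free triangle

    module _ (no-codart : (codart -free) G) where

      non-neighbours-pawFree : ∀ v S → PawFree (filter (∁? (v ~?_)) S)
      non-neighbours-pawFree v S a∈ b∈ c∈ d∈ a~b a~c b~c a~d =
        codart-free⇒ no-codart a~b a~c b~c a~d (non a∈) (non b∈) (non c∈) (non d∈)
        where
        non : ∀ {x} → x ∈ filter (∁? (v ~?_)) S → ¬ v ~ x
        non = proj₂ ∘ ∈-filter⁻ (∁? (v ~?_)) {xs = S}

      cliqueFree-colouring : ∀ k S → ¬ Clique S (suc k) → Colouring S (suc k C 2)
      cliqueFree-colouring zero S no-vertex =
        colouring-empty (no-vertex ∘ clique₁)
      cliqueFree-colouring (suc zero) S no-edge =
        independent-colouring λ x∈S y∈S → no-edge ∘ clique₂ x∈S y∈S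
      cliqueFree-colouring (suc (suc zero)) S no-triangle =
        triangleFree-colouring S no-triangle
      cliqueFree-colouring (suc (suc (suc j))) [] _ =
        colouring-empty λ ()
      cliqueFree-colouring (suc (suc (suc j))) (v ∷ S) no-clique =
        subst (Colouring (v ∷ S)) (≡.sym (suc-C-2 (3 + j)))
          (colouring-split (v ~?_)
            (cliqueFree-colouring (suc (suc j)) _ (no-clique ∘ clique-∷ (here refl))) others)
        where
        others : Colouring (filter (∁? (v ~?_)) (v ∷ S)) (3 + j)
        others = pawFree-colouring _ (s≤s (s≤s (s≤s z≤n))) (non-neighbours-pawFree v (v ∷ S))
                                   (no-clique ∘ clique-⊆ (filter-⊆ (∁? (v ~?_)) (v ∷ S)))

mainTheorem8 : ∀ {n} (G : Graph n) (w : ℕ) → IsCliqueNumber G w →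
    (fork -free) G → (codart -free) G → Colourable G (suc w C 2)
mainTheorem8 G w (_ , no-bigger-clique) no-fork no-codart =
  colourable G (cliqueFree-colouring G no-fork no-codart w (allFin _)
                                         (no-bigger-clique ∘ hasClique G))
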